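{- Let $\equiv$ be a lattice congruence of the weak order on $S_n$ with restriction $\equiv^*$ on $S_{n-1}$, and let $F_A=A_1|\cdots|A_k$ and $F_B=B_1|\cdots|B_{k'}$ be ordered partitions of $[n-1]$. If $\check{c}_i(F_A)\equiv\check{c}_j(F_B)$ for some $i\in\{0,\ldots,k\}$ and $j\in\{0,\ldots,k'\}$, or $\hat{c}_i(F_A)\equiv\hat{c}_j(F_B)$ for some $i\in[k]$ and $j\in[k']$, then $F_A\equiv^*F_B$.
   Context: $S_n$ carries the weak order (inclusion of inversion sets), a lattice; permutations are words. The restriction $\equiv^*$ is the relation on $S_{n-1}$ with $\sigma\equiv^*\pi$ iff $\sigma\cdot n\equiv\pi\cdot n$ (concatenation); it is a lattice congruence. An ordered partition $A_1|\cdots|A_k$ is identified with the set of permutations listing $A_1$ first in any order, then $A_2$, etc.; two ordered partitions are equivalent under a congruence if each permutation of one is equivalent to some permutation of the other and vice versa. For $F=A_1|\cdots|A_l$ of $[n-1]$: $\check{c}_k(F)=A_1|\cdots|A_k|\{n\}|A_{k+1}|\cdots|A_l$ for $k=0,\ldots,l$, and $\hat{c}_k(F)=A_1|\cdots|A_{k-1}|A_k\cup\{n\}|A_{k+1}|\cdots|A_l$ for $k=1,\ldots,l$. -}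

module Defs where

open import Data.Nat using (ℕ; zero; suc; _<_; _≤_)
open import Data.List using (List; []; _∷_; _++_; [_]; applyUpTo; concat; take; drop)
open import Data.List.Relation.Binary.Permutation.Propositional using (_↭_)
open import Data.List.Relation.Binary.Pointwise using (Pointwise)
open import Data.Product using (Σ; ∃; _×_; _,_)
open import Relation.Binary.PropositionalEquality using (_≡_; _≢_)
open import Data.List.Relation.Unary.All using (All)

upto1 : ℕ → List ℕ
upto1 n = applyUpTo suc n

IsPerm : ℕ → List ℕ → Set
IsPerm n w = w ↭ upto1 n

Inv : List ℕ → ℕ → ℕ → Set
Inv w a b = a < b × ∃ λ xs → ∃ λ ys → ∃ λ zs → w ≡ xs ++ b ∷ ys ++ a ∷ zs

_≤w_ : List ℕ → List ℕ → Set
σ ≤w π = ∀ a b → Inv σ a b → Inv π a b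

IsMeet : ℕ → List ℕ → List ℕ → List ℕ → Set
IsMeet n x y m = IsPerm n m × m ≤w x × m ≤w y
  × (∀ z → IsPerm n z → z ≤w x → z ≤w y → z ≤w m)

IsJoin : ℕ → List ℕ → List ℕ → List ℕ → Set
IsJoin n x y j = IsPerm n j × x ≤w j × y ≤w j
  × (∀ z → IsPerm n z → x ≤w z → y ≤w z → j ≤w z)

-- a lattice congruence of the weak order on S_n, given as a relation on words
-- (only its values on permutations of [n] matter)
record IsLatticeCongruence (n : ℕ) (R : List ℕ → List ℕ → Set) : Set where
  field
    refl′  : ∀ x → IsPerm n x → R x x
    sym′   : ∀ x y → IsPerm n x → IsPerm n y → R x y → R y x
    trans′ : ∀ x y z → IsPerm n x → IsPerm n y → IsPerm n z →
             R x y → R y z → R x z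
    meet-compat : ∀ x x′ y y′ m m′ →
      IsPerm n x → IsPerm n x′ → IsPerm n y → IsPerm n y′ →
      R x x′ → R y y′ → IsMeet n x y m → IsMeet n x′ y′ m′ → R m m′
    join-compat : ∀ x x′ y y′ j j′ →
      IsPerm n x → IsPerm n x′ → IsPerm n y → IsPerm n y′ →
      R x x′ → R y y′ → IsJoin n x y j → IsJoin n x′ y′ j′ → R j j′

-- restriction ≡* on S_{n-1} of a relation on S_n (here n = suc m)
Restrict : ℕ → (List ℕ → List ℕ → Set) → List ℕ → List ℕ → Set
Restrict m R σ π = R (σ ++ [ suc m ]) (π ++ [ suc m ])

IsOrderedPartition : ℕ → List (List ℕ) → Set
IsOrderedPartition m F = All (λ A → A ≢ []) F × concat F ↭ upto1 m

-- w belongs to (the set of permutations of) the ordered partition F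
InOP : List (List ℕ) → List ℕ → Set
InOP F w = ∃ λ ws → Pointwise _↭_ ws F × w ≡ concat ws

OPEquiv : (List ℕ → List ℕ → Set) → List (List ℕ) → List (List ℕ) → Set
OPEquiv R F G = (∀ w → InOP F w → ∃ λ w′ → InOP G w′ × R w w′)
              × (∀ w′ → InOP G w′ → ∃ λ w → InOP F w × R w w′)

-- čₖ(F) = A₁|⋯|Aₖ|{n}|A_{k+1}|⋯|A_l   (k = 0,…,l)
checkc : ℕ → ℕ → List (List ℕ) → List (List ℕ)
checkc n k F = take k F ++ [ n ] ∷ drop k F

-- ĉₖ(F) = A₁|⋯|A_{k-1}|Aₖ ∪ {n}|A_{k+1}|⋯|A_l   (k = 1,…,l; 1-based)
hatc : ℕ → ℕ → List (List ℕ) → List (List ℕ)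
hatc n (suc zero) (A ∷ F) = (A ++ [ n ]) ∷ F
hatc n (suc (suc k)) (A ∷ F) = A ∷ hatc n (suc k) F
hatc n _ F = F

-- Meeting with the permutation m⋯21(m+1), the largest permutation of [m+1] ending in m+1,
-- deletes the letter m+1 from a word and appends it at the end: for u = p(m+1)s the meet is
-- (ps)(m+1).  A lattice congruence respects meets, so u ≡ u′ forces ps(m+1) ≡ p′s′(m+1).
-- Every word of F_A arises from a word of č_i(F_A) (resp. ĉ_i(F_A)) by deleting m+1 and
-- conversely, and likewise for F_B, which transports the equivalence down to ≡*.
module Submission where

open import Defs
open import Data.Nat using (ℕ; zero; suc; _≤_; _<_; z≤n; s≤s; s<s; s<s⁻¹)
open import Data.Nat.Properties using (<-trans; <-≤-trans; <⇒≢; m≤n⇒m<n∨m≡n)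
open import Data.List using (List; []; _∷_; _++_; [_]; length; concat; applyDownFrom)
open import Data.List.Properties using (++-assoc; applyUpTo-∷ʳ; ∷-injective; ++-identityʳ; ++-conicalʳ)
open import Data.List.Membership.Propositional using (_∈_)
open import Data.List.Membership.Propositional.Properties
  using (∈-++⁺ˡ; ∈-++⁺ʳ; ∈-++⁻; ∈-∃++; ∈-applyUpTo⁻; ∈-applyDownFrom⁺; ∈-applyDownFrom⁻)
open import Data.List.Relation.Unary.Any using (here; there)
open import Data.List.Relation.Binary.Permutation.Propositional using (_↭_; ↭-refl; ↭-sym; ↭-trans)
open import Data.List.Relation.Binary.Permutation.Propositional.Properties
  using (∈-resp-↭; ↭-singleton-inv; drop-mid; ++⁺ʳ; ++⁺; shift; ∷↭∷ʳ)
open import Data.List.Relation.Binary.Pointwise using (Pointwise; []; _∷_)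
open import Data.Product using (∃; ∃₂; _×_; _,_; proj₂)
open import Data.Sum using (_⊎_; inj₁; inj₂)
open import Relation.Nullary using (contradiction)
open import Relation.Binary.PropositionalEquality using (_≡_; _≢_; refl; sym; subst)

Precedes : List ℕ → ℕ → ℕ → Set
Precedes w x y = ∃₂ λ xs ys → w ≡ xs ++ x ∷ ys × y ∈ ys

Inv⇒Precedes : ∀ {w a b} → Inv w a b → Precedes w b a
Inv⇒Precedes {a = a} (_ , xs , ys , zs , refl) = xs , ys ++ a ∷ zs , refl , ∈-++⁺ʳ ys (here refl)

Precedes⇒Inv : ∀ {w a b} → a < b → Precedes w b a → Inv w a b
Precedes⇒Inv a<b (xs , _ , refl , a∈) with ys , zs , refl ← ∈-∃++ a∈ = a<b , xs , ys , zs , refl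

Precedes-∈ˡ : ∀ {w x y} → Precedes w x y → x ∈ w
Precedes-∈ˡ (xs , _ , refl , _) = ∈-++⁺ʳ xs (here refl)

Precedes-∈ʳ : ∀ {w x y} → Precedes w x y → y ∈ w
Precedes-∈ʳ (xs , _ , refl , y∈) = ∈-++⁺ʳ xs (there y∈)

Precedes-∷ : ∀ z {w x y} → Precedes w x y → Precedes (z ∷ w) x y
Precedes-∷ z (xs , ys , refl , y∈) = z ∷ xs , ys , refl , y∈

Precedes-∷ʳ : ∀ {w x y} c → Precedes w x y → Precedes (w ++ [ c ]) x y
Precedes-∷ʳ {x = x} c (xs , ys , refl , y∈) = xs , ys ++ [ c ] , ++-assoc xs (x ∷ ys) [ c ] , ∈-++⁺ˡ y∈

Precedes-∷ʳ⁻ : ∀ w {c x y} → y ≢ c → Precedes (w ++ [ c ]) x y → Precedes w x y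
Precedes-∷ʳ⁻ [] _ ([] , ys , e , y∈) with refl , refl ← ∷-injective e with () ← y∈
Precedes-∷ʳ⁻ [] _ (_ ∷ xs , ys , e , _) with () ← ++-conicalʳ xs _ (sym (proj₂ (∷-injective e)))
Precedes-∷ʳ⁻ (z ∷ w) y≢c ([] , ys , e , y∈) with refl , refl ← ∷-injective e with ∈-++⁻ w y∈
... | inj₁ y∈w = [] , w , refl , y∈w
... | inj₂ (here y≡c) = contradiction y≡c y≢c
Precedes-∷ʳ⁻ (z ∷ w) y≢c (_ ∷ xs , ys , e , y∈) with refl , e′ ← ∷-injective e =
  Precedes-∷ z (Precedes-∷ʳ⁻ w y≢c (xs , ys , e′ , y∈))

∈-insert : ∀ {y : ℕ} c p {s} → y ∈ p ++ s → y ∈ p ++ c ∷ s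
∈-insert c p {s} y∈ = ∈-resp-↭ (↭-sym (shift c p s)) (there y∈)

∈-delete : ∀ {y c : ℕ} p {s} → y ≢ c → y ∈ p ++ c ∷ s → y ∈ p ++ s
∈-delete {c = c} p {s} y≢c y∈ with ∈-resp-↭ (shift c p s) y∈
... | here y≡c = contradiction y≡c y≢c
... | there y∈′ = y∈′

Precedes-insert : ∀ c p {s x y} → Precedes (p ++ s) x y → Precedes (p ++ c ∷ s) x y
Precedes-insert c [] pr = Precedes-∷ c pr
Precedes-insert c (z ∷ p) ([] , ys , e , y∈) with refl , refl ← ∷-injective e =
  [] , p ++ c ∷ _ , refl , ∈-insert c p y∈
Precedes-insert c (z ∷ p) (_ ∷ xs , ys , e , y∈) with refl , e′ ← ∷-injective e =
  Precedes-∷ z (Precedes-insert c p (xs , ys , e′ , y∈))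

Precedes-delete : ∀ c p {s x y} → x ≢ c → y ≢ c → Precedes (p ++ c ∷ s) x y → Precedes (p ++ s) x y
Precedes-delete c [] x≢c _ ([] , ys , e , _) with refl , _ ← ∷-injective e = contradiction refl x≢c
Precedes-delete c [] _ _ (_ ∷ xs , ys , e , y∈) with refl , e′ ← ∷-injective e = xs , ys , e′ , y∈
Precedes-delete c (z ∷ p) _ y≢c ([] , ys , e , y∈) with refl , refl ← ∷-injective e =
  [] , p ++ _ , refl , ∈-delete p y≢c y∈
Precedes-delete c (z ∷ p) x≢c y≢c (_ ∷ xs , ys , e , y∈) with refl , e′ ← ∷-injective e =
  Precedes-∷ z (Precedes-delete c p x≢c y≢c (xs , ys , e′ , y∈))

IsPerm-∷ʳ : ∀ m {w} → w ↭ upto1 m → IsPerm (suc m) (w ++ [ suc m ])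
IsPerm-∷ʳ m {w} w↭ = subst (w ++ [ suc m ] ↭_) (applyUpTo-∷ʳ suc m) (++⁺ʳ [ suc m ] w↭)

IsPerm-insert : ∀ m p {s} → p ++ s ↭ upto1 m → IsPerm (suc m) (p ++ suc m ∷ s)
IsPerm-insert m p {s} ps↭ = ↭-trans (shift (suc m) p s) (↭-trans (∷↭∷ʳ (suc m) (p ++ s)) (IsPerm-∷ʳ m ps↭))

applyDownFrom↭upto1 : ∀ m → applyDownFrom suc m ↭ upto1 m
applyDownFrom↭upto1 zero = ↭-refl
applyDownFrom↭upto1 (suc m) = ↭-trans (∷↭∷ʳ (suc m) _) (IsPerm-∷ʳ m (applyDownFrom↭upto1 m))

Precedes-applyDownFrom : ∀ {i j m} → i < j → j < m → Precedes (applyDownFrom suc m) (suc j) (suc i)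
Precedes-applyDownFrom {i} {j} {suc m} i<j (s≤s j≤m) with m≤n⇒m<n∨m≡n j≤m
... | inj₂ refl = [] , _ , refl , ∈-applyDownFrom⁺ suc i<j
... | inj₁ j<m = Precedes-∷ (suc m) (Precedes-applyDownFrom i<j j<m)

maxEndingIn : ℕ → List ℕ
maxEndingIn m = applyDownFrom suc m ++ [ suc m ]

IsPerm-maxEndingIn : ∀ m → IsPerm (suc m) (maxEndingIn m)
IsPerm-maxEndingIn m = IsPerm-∷ʳ m (applyDownFrom↭upto1 m)

Inv-∷ʳ⁻ : ∀ m w {a b} → IsPerm (suc m) (w ++ [ suc m ]) → Inv (w ++ [ suc m ]) a b → Precedes w b a
Inv-∷ʳ⁻ m w perm inv@(a<b , _) = Precedes-∷ʳ⁻ w (<⇒≢ a<n) pr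
  where
  pr : Precedes (w ++ [ suc m ]) _ _
  pr = Inv⇒Precedes inv
  a<n : _ < suc m
  a<n with j , j<n , refl ← ∈-applyUpTo⁻ suc (∈-resp-↭ perm (Precedes-∈ˡ pr)) = <-≤-trans a<b j<n

meet-maxEndingIn : ∀ m p {s} → p ++ s ↭ upto1 m →
  IsMeet (suc m) (p ++ suc m ∷ s) (maxEndingIn m) ((p ++ s) ++ [ suc m ])
meet-maxEndingIn m p {s} ps↭ = IsPerm-∷ʳ m ps↭ , below-insertion , below-max , greatest
  where
  n : ℕ
  n = suc m

  deleted : ∀ {a b} → Inv ((p ++ s) ++ [ n ]) a b → Precedes (p ++ s) b a
  deleted = Inv-∷ʳ⁻ m (p ++ s) (IsPerm-∷ʳ m ps↭)

  below-insertion : ((p ++ s) ++ [ n ]) ≤w (p ++ n ∷ s)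
  below-insertion a b inv@(a<b , _) = Precedes⇒Inv a<b (Precedes-insert n p (deleted inv))

  below-max : ((p ++ s) ++ [ n ]) ≤w maxEndingIn m
  below-max a b inv@(a<b , _)
    with i , _ , refl ← ∈-applyUpTo⁻ suc (∈-resp-↭ ps↭ (Precedes-∈ʳ (deleted inv)))
       | j , j<m , refl ← ∈-applyUpTo⁻ suc (∈-resp-↭ ps↭ (Precedes-∈ˡ (deleted inv)))
    = Precedes⇒Inv a<b (Precedes-∷ʳ n (Precedes-applyDownFrom (s<s⁻¹ a<b) j<m))

  greatest : ∀ z → IsPerm n z → z ≤w (p ++ n ∷ s) → z ≤w maxEndingIn m → z ≤w ((p ++ s) ++ [ n ])
  greatest z _ z≤u z≤max a b inv@(a<b , _) =
    Precedes⇒Inv a<b (Precedes-∷ʳ n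
      (Precedes-delete n p (<⇒≢ b<n) (<⇒≢ (<-trans a<b b<n)) (Inv⇒Precedes (z≤u a b inv))))
    where
    b<n : b < n
    b<n with j , j<m , refl ← ∈-applyDownFrom⁻ suc
               (Precedes-∈ˡ (Inv-∷ʳ⁻ m _ (IsPerm-maxEndingIn m) (z≤max a b inv)))
      = s<s j<m

Insertion : ℕ → List ℕ → List ℕ → Set
Insertion n u w = ∃₂ λ p s → u ≡ p ++ n ∷ s × w ≡ p ++ s

Restrict-fromInsertions : ∀ {m R u u′ w w′} → IsLatticeCongruence (suc m) R →
  w ↭ upto1 m → w′ ↭ upto1 m → Insertion (suc m) u w → Insertion (suc m) u′ w′ →
  R u u′ → Restrict m R w w′
Restrict-fromInsertions {m} congruence w↭ w′↭ (p , _ , refl , refl) (p′ , _ , refl , refl) Ruu′ =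
  meet-compat _ _ _ _ _ _ (IsPerm-insert m p w↭) (IsPerm-insert m p′ w′↭) max-perm max-perm
    Ruu′ (refl′ _ max-perm) (meet-maxEndingIn m p w↭) (meet-maxEndingIn m p′ w′↭)
  where
  open IsLatticeCongruence congruence
  max-perm : IsPerm (suc m) (maxEndingIn m)
  max-perm = IsPerm-maxEndingIn m

Insertion-∷ : ∀ n w → Insertion n (n ∷ w) w
Insertion-∷ n w = [] , w , refl , refl

Insertion-++ˡ : ∀ {n u w} v → Insertion n u w → Insertion n (v ++ u) (v ++ w)
Insertion-++ˡ v (p , s , refl , refl) = v ++ p , s , sym (++-assoc v p _) , sym (++-assoc v p s)

BlockInsertion : ℕ → List (List ℕ) → List (List ℕ) → Set
BlockInsertion n G F =
    (∀ {ws} → Pointwise _↭_ ws F → ∃ λ vs → Pointwise _↭_ vs G × Insertion n (concat vs) (concat ws))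
  × (∀ {vs} → Pointwise _↭_ vs G → ∃ λ ws → Pointwise _↭_ ws F × Insertion n (concat vs) (concat ws))

checkc-BlockInsertion : ∀ n i F → BlockInsertion n (checkc n i F) F
checkc-BlockInsertion n i F = lift i , drop i F
  where
  lift : ∀ i {F ws} → Pointwise _↭_ ws F →
    ∃ λ vs → Pointwise _↭_ vs (checkc n i F) × Insertion n (concat vs) (concat ws)
  lift zero pw = _ , ↭-refl ∷ pw , Insertion-∷ n _
  lift (suc i) [] = _ , ↭-refl ∷ [] , Insertion-∷ n []
  lift (suc i) (_∷_ {x = w} w↭ pw) with vs , pv , ins ← lift i pw = w ∷ vs , w↭ ∷ pv , Insertion-++ˡ w ins

  drop : ∀ i F {vs} → Pointwise _↭_ vs (checkc n i F) →
    ∃ λ ws → Pointwise _↭_ ws F × Insertion n (concat vs) (concat ws)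
  drop zero F (v↭ ∷ pv) with refl ← ↭-singleton-inv v↭ = _ , pv , Insertion-∷ n _
  drop (suc i) [] (v↭ ∷ []) with refl ← ↭-singleton-inv v↭ = [] , [] , Insertion-∷ n []
  drop (suc i) (A ∷ F) (_∷_ {x = v} v↭ pv) with ws , pw , ins ← drop i F pv = v ∷ ws , v↭ ∷ pw , Insertion-++ˡ v ins

hatc-BlockInsertion : ∀ n i F → i < length F → BlockInsertion n (hatc n (suc i) F) F
hatc-BlockInsertion n i F i<l = lift i i<l , drop i F i<l
  where
  lift : ∀ i {F ws} → i < length F → Pointwise _↭_ ws F →
    ∃ λ vs → Pointwise _↭_ vs (hatc n (suc i) F) × Insertion n (concat vs) (concat ws)
  lift zero _ (_∷_ {x = w} {xs = ws} w↭ pw) =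
    (w ++ [ n ]) ∷ ws , ++⁺ʳ [ n ] w↭ ∷ pw , w , concat ws , ++-assoc w [ n ] (concat ws) , refl
  lift (suc i) (s≤s i<l) (_∷_ {x = w} w↭ pw) with vs , pv , ins ← lift i i<l pw =
    w ∷ vs , w↭ ∷ pv , Insertion-++ˡ w ins

  drop : ∀ i F {vs} → i < length F → Pointwise _↭_ vs (hatc n (suc i) F) →
    ∃ λ ws → Pointwise _↭_ ws F × Insertion n (concat vs) (concat ws)
  drop zero (A ∷ F) _ (_∷_ {xs = vs} v↭ pv)
    with q , r , refl ← ∈-∃++ (∈-resp-↭ (↭-sym v↭) (∈-++⁺ʳ A (here refl))) =
    (q ++ r) ∷ vs , subst (q ++ r ↭_) (++-identityʳ A) (drop-mid q A v↭) ∷ pv ,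
    q , r ++ concat vs , ++-assoc q (n ∷ r) (concat vs) , ++-assoc q r (concat vs)
  drop (suc i) (A ∷ F) (s≤s i<l) (_∷_ {x = v} v↭ pv) with ws , pw , ins ← drop i F i<l pv =
    v ∷ ws , v↭ ∷ pw , Insertion-++ˡ v ins

InOP-↭ : ∀ {m F w} → concat F ↭ upto1 m → InOP F w → w ↭ upto1 m
InOP-↭ F↭ (_ , pw , refl) = ↭-trans (concat-↭ pw) F↭
  where
  concat-↭ : ∀ {ws F} → Pointwise _↭_ ws F → concat ws ↭ concat F
  concat-↭ [] = ↭-refl
  concat-↭ (w↭ ∷ pw) = ++⁺ w↭ (concat-↭ pw)

OPEquiv-Restrict : ∀ {m R FA FB GA GB} → IsLatticeCongruence (suc m) R →
  concat FA ↭ upto1 m → concat FB ↭ upto1 m →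
  BlockInsertion (suc m) GA FA → BlockInsertion (suc m) GB FB →
  OPEquiv R GA GB → OPEquiv (Restrict m R) FA FB
OPEquiv-Restrict {m} {R} {FA} {FB} congruence FA↭ FB↭ (liftA , dropA) (liftB , dropB) (to , from) = to′ , from′
  where
  to′ : ∀ w → InOP FA w → ∃ λ w′ → InOP FB w′ × Restrict m R w w′
  to′ _ w∈@(_ , pw , refl)
    with vs , pv , ins ← liftA pw
    with _ , (_ , pv′ , refl) , Ruu′ ← to (concat vs) (vs , pv , refl)
    with ws′ , pw′ , ins′ ← dropB pv′
    = concat ws′ , w′∈ , Restrict-fromInsertions congruence (InOP-↭ FA↭ w∈) (InOP-↭ FB↭ w′∈) ins ins′ Ruu′
    where
    w′∈ : InOP FB (concat ws′)
    w′∈ = ws′ , pw′ , refl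

  from′ : ∀ w′ → InOP FB w′ → ∃ λ w → InOP FA w × Restrict m R w w′
  from′ _ w′∈@(_ , pw′ , refl)
    with vs′ , pv′ , ins′ ← liftB pw′
    with _ , (_ , pv , refl) , Ruu′ ← from (concat vs′) (vs′ , pv′ , refl)
    with ws , pw , ins ← dropA pv
    = concat ws , w∈ , Restrict-fromInsertions congruence (InOP-↭ FA↭ w∈) (InOP-↭ FB↭ w′∈) ins ins′ Ruu′
    where
    w∈ : InOP FA (concat ws)
    w∈ = ws , pw , refl

lemma32 : (m : ℕ) (R : List ℕ → List ℕ → Set) → IsLatticeCongruence (suc m) R →
    (FA FB : List (List ℕ)) → IsOrderedPartition m FA → IsOrderedPartition m FB →
    ((∃ λ i → ∃ λ j → i ≤ length FA × j ≤ length FB ×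
        OPEquiv R (checkc (suc m) i FA) (checkc (suc m) j FB))
     ⊎ (∃ λ i → ∃ λ j → 1 ≤ i × i ≤ length FA × 1 ≤ j × j ≤ length FB ×
        OPEquiv R (hatc (suc m) i FA) (hatc (suc m) j FB))) →
    OPEquiv (Restrict m R) FA FB
lemma32 m R congruence FA FB (_ , FA↭) (_ , FB↭) (inj₁ (i , j , _ , _ , E)) =
  OPEquiv-Restrict congruence FA↭ FB↭ (checkc-BlockInsertion (suc m) i FA) (checkc-BlockInsertion (suc m) j FB) E
lemma32 m R congruence FA FB (_ , FA↭) (_ , FB↭) (inj₂ (suc i , suc j , s≤s z≤n , i<l , s≤s z≤n , j<l , E)) =
  OPEquiv-Restrict congruence FA↭ FB↭ (hatc-BlockInsertion (suc m) i FA i<l) (hatc-BlockInsertion (suc m) j FB j<l) E
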